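{- Let $k\geq 1$ and $n\geq 3$ be integers, let $D_{k,n}=D^{0}_{k-1,n}\oplus D^{1}_{k-1,n}\oplus\cdots\oplus D^{t_{k-1,n}}_{k-1,n}$ be the $k$-dimensional data center network with $n$-port switches, let $t\geq 3$, and let $\{i_1,\dots,i_t\}\subseteq\{0,1,\dots,t_{k-1,n}\}$. Let $H$ be the subgraph of $D_{k,n}$ induced by $\bigcup_{q\in\{i_1,\dots,i_t\}}V(D^{q}_{k-1,n})$. Then $\kappa(H)\geq 2$.
   Context: $\kappa$ denotes vertex connectivity. The data center network $D_{k,n}$ ($k\geq 0$, $n\geq 2$): set $t_{0,n}=n$ and $t_{i,n}=t_{i-1,n}(t_{i-1,n}+1)$ for $i\geq 1$. The vertices of $D_{k,n}$ are tuples $(a_k,\dots,a_0)$ with $a_0\in\{0,\dots,n-1\}$ and $a_i\in\{0,1,\dots,t_{i-1,n}\}$ for $1\leq i\leq k$. For $0\le j\le k$ let $\mathrm{uid}_j(a)=a_0+\sum_{\ell=1}^{j}a_\ell\, t_{\ell-1,n}$. $D_{0,n}$ is the complete graph $K_n$. For $k>0$, $D_{k,n}$ consists of $t_{k-1,n}+1$ disjoint copies $D^{0}_{k-1,n},\dots,D^{t_{k-1,n}}_{k-1,n}$ of $D_{k-1,n}$, where $D^{r}_{k-1,n}$ consists of the vertices with $a_k=r$, two such vertices being adjacent iff their suffixes $(a_{k-1},\dots,a_0)$ are adjacent in $D_{k-1,n}$; additionally, for $r<s$, a vertex $a$ of $D^{r}_{k-1,n}$ and a vertex $b$ of $D^{s}_{k-1,n}$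 are adjacent iff $a_k=r=\mathrm{uid}_{k-1}(b)$ and $b_k=s=\mathrm{uid}_{k-1}(a)+1$. No other edges exist. -}

module Defs where

open import Data.Nat using (ℕ; zero; suc; _+_; _*_; _<_)
open import Data.Fin using (Fin; toℕ)
open import Data.Product using (_×_; _,_; Σ; ∃-syntax)
open import Data.Sum using (_⊎_)
open import Relation.Binary.PropositionalEquality using (_≡_; _≢_)

t : ℕ → ℕ → ℕ
t zero n = n
t (suc i) n = t i n * (t i n + 1)

-- Vertices of D_{k,n}: tuples (a_k, ..., a_0), with a_0 ∈ {0..n-1}
-- and a_i ∈ {0, ..., t_{i-1,n}}.  Vertex (suc k) n = (a_{k+1} , suffix).
Vertex : ℕ → ℕ → Set
Vertex zero n = Fin n
Vertex (suc k) n = Fin (suc (t k n)) × Vertex k n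

uid : ∀ k n → Vertex k n → ℕ
uid zero n a = toℕ a
uid (suc k) n (r , a) = toℕ r * t k n + uid k n a

Adj : ∀ k n → Vertex k n → Vertex k n → Set
Adj zero n a b = a ≢ b
Adj (suc k) n (r , a) (s , b) =
  (r ≡ s × Adj k n a b)
  ⊎ (toℕ r < toℕ s × toℕ r ≡ uid k n b × toℕ s ≡ uid k n a + 1)
  ⊎ (toℕ s < toℕ r × toℕ s ≡ uid k n a × toℕ r ≡ uid k n b + 1)

data Walk {V : Set} (E : V → V → Set) (P : V → Set) : V → V → Set where
  here : ∀ {x} → P x → Walk E P x x
  step : ∀ {x y z} → P x → E x y → Walk E P y z → Walk E P x z

Connected : {V : Set} → (V → V → Set) → (V → Set) → Set
Connected {V} E P = (x y : V) → P x → P y → Walk E P x y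

-- κ(G[P]) ≥ 2: G[P] has at least 3 vertices (so removing ≤ 1 vertex never
-- leaves a trivial graph), is connected, and stays connected after deleting
-- any single vertex (no cut set of size ≤ 1).
KappaAtLeast2 : {V : Set} → (V → V → Set) → (V → Set) → Set
KappaAtLeast2 {V} E P =
  (∃[ x ] ∃[ y ] ∃[ z ] (P x × P y × P z × x ≢ y × x ≢ z × y ≢ z))
  × Connected E P
  × ((v : V) → P v → Connected E (λ x → P x × x ≢ v))

-- Vertex set of the union of the copies D^q_{k-1,n}, q ∈ S (here D_{suc k, n})
InCopies : ∀ k n → (Fin (suc (t k n)) → Set) → Vertex (suc k) n → Set
InCopies k n S (r , a) = S r

{-# OPTIONS --safe #-}
module Submission where

-- By induction on k, every D_{k,n} with n ≥ 3 is 2-connected (for k = 0 it is K_n).  In a union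
-- of at least three copies of D_{k,n}, two copies r < s are joined by the edge between the vertex
-- of copy r with uid s - 1 and the vertex of copy s with uid r, since uid is onto [0, t_{k,n}).
-- Every vertex has at most one neighbour outside its own copy, so a deleted vertex v that is an
-- endpoint of this edge lies on no edge into a third copy m, and the copies r and s stay linked
-- through m.  Taking all t_{k,n} + 1 ≥ 3 copies gives the induction step, and any three copies
-- give the theorem.

open import Defs
open import Data.Nat using (ℕ; zero; suc; _+_; _*_; _≤_; _<_; z≤n; s≤s; NonZero; >-nonZero)
open import Data.Nat.Properties
  using (<-cmp; ≤-refl; ≤-reflexive; ≤-trans; ≤-<-trans; <-≤-trans; <⇒≱; m≤n⇒m≤1+n; m<1+n⇒m≤n;
         +-comm; +-suc; *-comm; +-monoʳ-≤; m≤m*n; m≤n+m; m*n≢0⇒m≢0; ∸-monoˡ-<; m∸n+n≡m; module ≤-Reasoning)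
open import Data.Nat.DivMod using (_/_; _%_; m<n*o⇒m/o<n; m%n<n; m≡m%n+[m/n]*n)
open import Data.Fin using (Fin; toℕ; fromℕ<) renaming (_≟_ to _≟ᶠ_)
open import Data.Fin.Properties using (toℕ-injective; toℕ-fromℕ<; toℕ<n; toℕ≤pred[n]; any?)
open import Data.Fin.Subset using (Subset; _∈_; _∉_; _⊆_; ∣_∣; _∪_; ⁅_⁆; inside; outside; ⊤; ⊥)
open import Data.Fin.Subset.Properties
  using (_∈?_; p⊆q⇒∣p∣≤∣q∣; ∣p∣≤∣x∷p∣; ∣⊥∣≡0; ∣⊤∣≡n; ∣⁅x⁆∣≡1; p⊆p∪q; q⊆p∪q; x∉⁅y⁆⇒x≢y; ∈⊤)
open import Data.Vec using ([]; _∷_)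
open import Data.Product using (_×_; _,_; proj₁; proj₂; ∃-syntax; ∃₂)
open import Data.Product.Properties using (≡-dec)
open import Data.Sum using (inj₁; inj₂)
open import Data.Unit using (tt) renaming (⊤ to Unit)
open import Function using (id; _∘_)
open import Function.Definitions using (Injective)
open import Relation.Nullary using (¬_; yes; no; ¬?; contradiction)
open import Relation.Nullary.Decidable using (_×-dec_; decidable-stable)
open import Relation.Binary using (tri<; tri≈; tri>; DecidableEquality)
open import Relation.Binary.PropositionalEquality
  using (_≡_; _≢_; refl; sym; trans; cong; cong₂; subst; module ≡-Reasoning)

_++ᵂ_ : ∀ {V : Set} {E : V → V → Set} {P : V → Set} {x y z : V} →
        Walk E P x y → Walk E P y z → Walk E P x z
here _       ++ᵂ w′ = w′
step p e w ++ᵂ w′ = step p e (w ++ᵂ w′)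

mapᵂ : ∀ {V W : Set} {E : V → V → Set} {P : V → Set} {F : W → W → Set} {Q : W → Set}
       (f : V → W) → (∀ {x y} → E x y → F (f x) (f y)) → (∀ {x} → P x → Q (f x)) →
       ∀ {x y} → Walk E P x y → Walk F Q (f x) (f y)
mapᵂ f f-hom f-pres (here p)     = here (f-pres p)
mapᵂ f f-hom f-pres (step p e w) = step (f-pres p) (f-hom e) (mapᵂ f f-hom f-pres w)

TwoConnected : {V : Set} → (V → V → Set) → Set
TwoConnected {V} E = Connected E (λ _ → Unit) × ((w : V) → Connected E (λ x → x ≢ w))

ThreeDistinct : {A : Set} → (A → Set) → Set
ThreeDistinct P = ∃[ x ] ∃[ y ] ∃[ z ] (P x × P y × P z × x ≢ y × x ≢ z × y ≢ z)

map-threeDistinct : ∀ {A B : Set} {P : A → Set} {Q : B → Set} (f : A → B) → Injective _≡_ _≡_ f →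
                    (∀ {x} → P x → Q (f x)) → ThreeDistinct P → ThreeDistinct Q
map-threeDistinct f f-inj f-pres (x , y , z , px , py , pz , x≢y , x≢z , y≢z) =
  f x , f y , f z , f-pres px , f-pres py , f-pres pz , x≢y ∘ f-inj , x≢z ∘ f-inj , y≢z ∘ f-inj

∣p∪q∣≤∣p∣+∣q∣ : ∀ {n} (p q : Subset n) → ∣ p ∪ q ∣ ≤ ∣ p ∣ + ∣ q ∣
∣p∪q∣≤∣p∣+∣q∣ []            []            = z≤n
∣p∪q∣≤∣p∣+∣q∣ (inside  ∷ p) (x       ∷ q) = s≤s (≤-trans (∣p∪q∣≤∣p∣+∣q∣ p q) (+-monoʳ-≤ ∣ p ∣ (∣p∣≤∣x∷p∣ x q)))
∣p∪q∣≤∣p∣+∣q∣ (outside ∷ p) (inside  ∷ q) = ≤-trans (s≤s (∣p∪q∣≤∣p∣+∣q∣ p q)) (≤-reflexive (sym (+-suc ∣ p ∣ ∣ q ∣)))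
∣p∪q∣≤∣p∣+∣q∣ (outside ∷ p) (outside ∷ q) = ∣p∪q∣≤∣p∣+∣q∣ p q

∣p∣<∣q∣⇒∃∈q∉p : ∀ {n} {p q : Subset n} → ∣ p ∣ < ∣ q ∣ → ∃[ x ] x ∈ q × x ∉ p
∣p∣<∣q∣⇒∃∈q∉p {p = p} {q} ∣p∣<∣q∣ with any? (λ x → (x ∈? q) ×-dec ¬? (x ∈? p))
... | yes x∈q∖p = x∈q∖p
... | no ∄x∈q∖p = contradiction (p⊆q⇒∣p∣≤∣q∣ q⊆p) (<⇒≱ ∣p∣<∣q∣)
  where
  q⊆p : q ⊆ p
  q⊆p {x} x∈q = decidable-stable (x ∈? p) (λ x∉p → ∄x∈q∖p (x , x∈q , x∉p))

∃∈-avoiding₂ : ∀ {n} (p : Subset n) → 3 ≤ ∣ p ∣ → (r s : Fin n) → ∃[ m ] m ∈ p × m ≢ r × m ≢ s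
∃∈-avoiding₂ p 3≤∣p∣ r s =
  let m , m∈p , m∉rs = ∣p∣<∣q∣⇒∃∈q∉p ∣rs∣<∣p∣
  in m , m∈p , x∉⁅y⁆⇒x≢y (m∉rs ∘ p⊆p∪q ⁅ s ⁆) , x∉⁅y⁆⇒x≢y (m∉rs ∘ q⊆p∪q ⁅ r ⁆ ⁅ s ⁆)
  where
  open ≤-Reasoning
  ∣rs∣<∣p∣ : ∣ ⁅ r ⁆ ∪ ⁅ s ⁆ ∣ < ∣ p ∣
  ∣rs∣<∣p∣ = begin-strict
    ∣ ⁅ r ⁆ ∪ ⁅ s ⁆ ∣      ≤⟨ ∣p∪q∣≤∣p∣+∣q∣ ⁅ r ⁆ ⁅ s ⁆ ⟩
    ∣ ⁅ r ⁆ ∣ + ∣ ⁅ s ⁆ ∣  ≡⟨ cong₂ _+_ (∣⁅x⁆∣≡1 r) (∣⁅x⁆∣≡1 s) ⟩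
    2                      <⟨ 3≤∣p∣ ⟩
    ∣ p ∣                  ∎

3≤∣p∣⇒threeDistinct : ∀ {n} (p : Subset n) → 3 ≤ ∣ p ∣ → ThreeDistinct (_∈ p)
3≤∣p∣⇒threeDistinct {n} p 3≤∣p∣ =
  let r , r∈p , _         = ∣p∣<∣q∣⇒∃∈q∉p {p = ⊥} (subst (_< ∣ p ∣) (sym (∣⊥∣≡0 n)) (≤-trans (s≤s z≤n) 3≤∣p∣))
      s , s∈p , s≢r , _   = ∃∈-avoiding₂ p 3≤∣p∣ r r
      m , m∈p , m≢r , m≢s = ∃∈-avoiding₂ p 3≤∣p∣ r s
  in r , s , m , r∈p , s∈p , m∈p , s≢r ∘ sym , m≢r ∘ sym , m≢s ∘ sym

m<n⇒n≮m+1 : ∀ {m n} → m < n → ¬ n < m + 1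
m<n⇒n≮m+1 {m} {n} m<n n<m+1 = <⇒≱ m<n (m<1+n⇒m≤n (subst (n <_) (+-comm m 1) n<m+1))

n≤t : ∀ k n → n ≤ t k n
n≤t zero    n = ≤-refl
n≤t (suc k) n = ≤-trans (n≤t k n) (m≤m*n (t k n) (t k n + 1) {{>-nonZero (m≤n+m 1 (t k n))}})

uid-surjective : ∀ k n {m} → m < t k n → ∃[ a ] uid k n a ≡ m
uid-surjective zero    n m<n = fromℕ< m<n , toℕ-fromℕ< m<n
uid-surjective (suc k) n {m} m<T*[T+1] =
  let a , uid-a≡m%T = uid-surjective k n (m%n<n m T)
  in (fromℕ< m/T<1+T , a) , (begin
       toℕ (fromℕ< m/T<1+T) * T + uid k n a  ≡⟨ cong₂ (λ q r → q * T + r) (toℕ-fromℕ< m/T<1+T) uid-a≡m%T ⟩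
       m / T * T + m % T                      ≡⟨ +-comm (m / T * T) (m % T) ⟩
       m % T + m / T * T                      ≡⟨ sym (m≡m%n+[m/n]*n m T) ⟩
       m                                      ∎)
  where
  open ≡-Reasoning
  T = t k n
  instance
    T≢0 : NonZero T
    T≢0 = m*n≢0⇒m≢0 T {{>-nonZero (≤-<-trans z≤n m<T*[T+1])}}
  m/T<1+T : m / T < suc T
  m/T<1+T = m<n*o⇒m/o<n (subst (m <_) (trans (*-comm T (T + 1)) (cong (_* T) (+-comm T 1))) m<T*[T+1])

Adj-sym : ∀ k n {x y} → Adj k n x y → Adj k n y x
Adj-sym zero    n x≢y                      = x≢y ∘ sym
Adj-sym (suc k) n (inj₁ (r≡s , a~b))       = inj₁ (sym r≡s , Adj-sym k n a~b)
Adj-sym (suc k) n (inj₂ (inj₁ r<s-edge))   = inj₂ (inj₂ r<s-edge)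
Adj-sym (suc k) n (inj₂ (inj₂ s<r-edge))   = inj₂ (inj₁ s<r-edge)

Vertex-≟ : ∀ k n → DecidableEquality (Vertex k n)
Vertex-≟ zero    n = _≟ᶠ_
Vertex-≟ (suc k) n = ≡-dec _≟ᶠ_ (Vertex-≟ k n)

Kₙ-connected : ∀ n (P : Fin n → Set) → Connected (Adj zero n) P
Kₙ-connected n P x y px py with x ≟ᶠ y
... | yes refl = here px
... | no x≢y   = step px x≢y (here py)

Kₙ-twoConnected : ∀ n → TwoConnected (Adj zero n)
Kₙ-twoConnected n = Kₙ-connected n _ , λ _ → Kₙ-connected n _

module Copies (k n : ℕ) where

  private
    Copy = Fin (suc (t k n))
    E    = Adj (suc k) n

  inCopyᵂ : ∀ r {P : Vertex k n → Set} {Q : Vertex (suc k) n → Set} → (∀ {a} → P a → Q (r , a)) →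
            ∀ {a b} → Walk (Adj k n) P a b → Walk E Q (r , a) (r , b)
  inCopyᵂ r = mapᵂ (r ,_) (λ a~b → inj₁ (refl , a~b))

  crossEdge< : ∀ {r s : Copy} → toℕ r < toℕ s → ∃₂ λ a b → E (r , a) (s , b)
  crossEdge< {r} {s} r<s =
    let 1≤s       = ≤-<-trans z≤n r<s
        a , uid-a = uid-surjective k n (∸-monoˡ-< (toℕ<n s) 1≤s)
        b , uid-b = uid-surjective k n (<-≤-trans r<s (toℕ≤pred[n] s))
    in a , b , inj₂ (inj₁ (r<s , sym uid-b , sym (trans (cong (_+ 1) uid-a) (m∸n+n≡m 1≤s))))

  crossEdge : ∀ {r s : Copy} → r ≢ s → ∃₂ λ a b → E (r , a) (s , b)
  crossEdge {r} {s} r≢s with <-cmp (toℕ r) (toℕ s)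
  ... | tri< r<s _ _ = crossEdge< r<s
  ... | tri≈ _ r≡s _ = contradiction (toℕ-injective r≡s) r≢s
  ... | tri> _ _ s<r = let a , b , e = crossEdge< s<r in b , a , Adj-sym (suc k) n e

  crossNeighbour-unique : ∀ {x y z} → E x y → E x z → proj₁ x ≢ proj₁ y → proj₁ x ≢ proj₁ z →
                          proj₁ y ≡ proj₁ z
  crossNeighbour-unique (inj₁ (r≡s , _)) _                 r≢s _   = contradiction r≡s r≢s
  crossNeighbour-unique (inj₂ _)         (inj₁ (r≡m , _))  _   r≢m = contradiction r≡m r≢m
  crossNeighbour-unique (inj₂ (inj₁ (_ , _ , s≡))) (inj₂ (inj₁ (_ , _ , m≡))) _ _ = toℕ-injective (trans s≡ (sym m≡))
  crossNeighbour-unique (inj₂ (inj₂ (_ , s≡ , _))) (inj₂ (inj₂ (_ , m≡ , _))) _ _ = toℕ-injective (trans s≡ (sym m≡))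
  crossNeighbour-unique (inj₂ (inj₁ (r<s , _ , s≡))) (inj₂ (inj₂ (m<r , m≡ , _))) _ _ =
    contradiction (subst (_ <_) s≡ r<s) (m<n⇒n≮m+1 (subst (_< _) m≡ m<r))
  crossNeighbour-unique (inj₂ (inj₂ (s<r , s≡ , _))) (inj₂ (inj₁ (r<m , _ , m≡))) _ _ =
    contradiction (subst (_ <_) m≡ r<m) (m<n⇒n≮m+1 (subst (_< _) s≡ s<r))

  crossEdge-endpoint-avoids-third : ∀ {r s a b} → E (r , a) (s , b) → r ≢ s →
    ∀ {m q c d} → E (q , c) (m , d) → m ≢ r → m ≢ s → (q , c) ≢ (r , a) × (m , d) ≢ (r , a)
  crossEdge-endpoint-avoids-third e r≢s e′ m≢r m≢s =
      (λ qc≡ra → m≢s (sym (crossNeighbour-unique e (subst (λ x → E x _) qc≡ra e′) r≢s (m≢r ∘ sym))))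
    , m≢r ∘ cong proj₁

module CopyUnion (k n : ℕ) (D-twoConnected : TwoConnected (Adj k n))
                 (S : Subset (suc (t k n))) (3≤∣S∣ : 3 ≤ ∣ S ∣) where

  open Copies k n

  private
    V    = Vertex (suc k) n
    E    = Adj (suc k) n
    _≟ᵛ_ = Vertex-≟ (suc k) n

  H : V → Set
  H = InCopies k n (_∈ S)

  H-∖ : V → V → Set
  H-∖ v x = H x × x ≢ v

  H-connected : Connected E H
  H-connected (r , a) (s , b) r∈S s∈S with r ≟ᶠ s
  ... | yes refl = inCopyᵂ r (λ _ → r∈S) (proj₁ D-twoConnected a b tt tt)
  ... | no r≢s =
    let a₁ , b₁ , e = crossEdge r≢s
    in  inCopyᵂ r (λ _ → r∈S) (proj₁ D-twoConnected a a₁ tt tt)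
    ++ᵂ step r∈S e (inCopyᵂ s (λ _ → s∈S) (proj₁ D-twoConnected b₁ b tt tt))

  withinCopy : ∀ v {r a b} → r ∈ S → (r , a) ≢ v → (r , b) ≢ v → Walk E (H-∖ v) (r , a) (r , b)
  withinCopy (c , w) {r} {a} {b} r∈S ra≢v rb≢v with r ≟ᶠ c
  ... | yes refl = inCopyᵂ r (λ x≢w → r∈S , x≢w ∘ cong proj₂)
                     (proj₂ D-twoConnected w a b (ra≢v ∘ cong (r ,_)) (rb≢v ∘ cong (r ,_)))
  ... | no r≢c   = inCopyᵂ r (λ _ → r∈S , r≢c ∘ cong proj₁)
                     (proj₁ D-twoConnected a b tt tt)

  viaEdge : ∀ v {r s a b a₁ b₁} → r ∈ S → s ∈ S → E (r , a₁) (s , b₁) →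
            (r , a) ≢ v → (r , a₁) ≢ v → (s , b₁) ≢ v → (s , b) ≢ v → Walk E (H-∖ v) (r , a) (s , b)
  viaEdge v r∈S s∈S e ra≢v ra₁≢v sb₁≢v sb≢v =
    withinCopy v r∈S ra≢v ra₁≢v ++ᵂ step (r∈S , ra₁≢v) e (withinCopy v s∈S sb₁≢v sb≢v)

  viaThirdCopy : ∀ v {r s a b} → r ∈ S → s ∈ S → (r , a) ≢ v → (s , b) ≢ v →
    (∀ {m q c d} → E (q , c) (m , d) → m ≢ r → m ≢ s → (q , c) ≢ v × (m , d) ≢ v) →
    Walk E (H-∖ v) (r , a) (s , b)
  viaThirdCopy v {r} {s} r∈S s∈S ra≢v sb≢v avoids =
    let m , m∈S , m≢r , m≢s = ∃∈-avoiding₂ S 3≤∣S∣ r s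
        a₂ , b₂ , e₂        = crossEdge (m≢r ∘ sym)
        a₃ , b₃ , e₃        = crossEdge (m≢s ∘ sym)
        ra₂≢v , mb₂≢v       = avoids e₂ m≢r m≢s
        sa₃≢v , mb₃≢v       = avoids e₃ m≢r m≢s
    in  viaEdge v r∈S m∈S e₂ ra≢v ra₂≢v mb₂≢v mb₃≢v
    ++ᵂ viaEdge v m∈S s∈S (Adj-sym (suc k) n e₃) mb₃≢v mb₃≢v sa₃≢v sb≢v

  betweenCopies : ∀ v {r s a b} → r ∈ S → s ∈ S → r ≢ s → (r , a) ≢ v → (s , b) ≢ v →
                  Walk E (H-∖ v) (r , a) (s , b)
  betweenCopies v {r} {s} r∈S s∈S r≢s ra≢v sb≢v with crossEdge r≢s
  ... | a₁ , b₁ , e with (r , a₁) ≟ᵛ v | (s , b₁) ≟ᵛ v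
  ... | no ra₁≢v | no sb₁≢v = viaEdge v r∈S s∈S e ra≢v ra₁≢v sb₁≢v sb≢v
  ... | yes refl | _        = viaThirdCopy v r∈S s∈S ra≢v sb≢v (crossEdge-endpoint-avoids-third e r≢s)
  ... | no _     | yes refl = viaThirdCopy v r∈S s∈S ra≢v sb≢v
    (λ e′ m≢r m≢s → crossEdge-endpoint-avoids-third (Adj-sym (suc k) n e) (r≢s ∘ sym) e′ m≢s m≢r)

  H-∖-connected : ∀ v → Connected E (H-∖ v)
  H-∖-connected v (r , a) (s , b) (r∈S , ra≢v) (s∈S , sb≢v) with r ≟ᶠ s
  ... | yes refl = withinCopy v r∈S ra≢v sb≢v
  ... | no r≢s   = betweenCopies v r∈S s∈S r≢s ra≢v sb≢v

D-twoConnected : ∀ k n → 3 ≤ n → TwoConnected (Adj k n)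
D-twoConnected zero    n _   = Kₙ-twoConnected n
D-twoConnected (suc k) n 3≤n =
    (λ x y _ _ → mapᵂ id id (λ _ → tt) (H-connected x y ∈⊤ ∈⊤))
  , (λ w x y x≢w y≢w → mapᵂ id id proj₂ (H-∖-connected w x y (∈⊤ , x≢w) (∈⊤ , y≢w)))
  where
  3≤∣⊤∣ : 3 ≤ ∣ ⊤ {suc (t k n)} ∣
  3≤∣⊤∣ = subst (3 ≤_) (sym (∣⊤∣≡n _)) (m≤n⇒m≤1+n (≤-trans 3≤n (n≤t k n)))
  open CopyUnion k n (D-twoConnected k n 3≤n) ⊤ 3≤∣⊤∣

lemma3p1 : (k n : ℕ) → 3 ≤ n → (tt : ℕ) → 3 ≤ tt →
    (S : Subset (suc (t k n))) → ∣ S ∣ ≡ tt →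
    KappaAtLeast2 (Adj (suc k) n) (InCopies k n (λ q → q ∈ S))
lemma3p1 k n 3≤n _ 3≤∣S∣ S refl =
    map-threeDistinct (_, vertex) (cong proj₁) id (3≤∣p∣⇒threeDistinct S 3≤∣S∣)
  , H-connected
  , λ v _ → H-∖-connected v
  where
  open CopyUnion k n (D-twoConnected k n 3≤n) S 3≤∣S∣
  vertex : Vertex k n
  vertex = proj₁ (uid-surjective k n (≤-trans (s≤s z≤n) (≤-trans 3≤n (n≤t k n))))
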